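{- Let $D$ be a positive integer, let $Q_D$ be the $D$-cube with vertex set $\mathcal X$, standard module $V=\mathbb C^{\mathcal X}$, adjacency matrix $\mathbf A$, and base vertex $\mathbf x$, and let $\mathbf A^*_{D-1}$ be the diagonal matrix with $(\mathbf y,\mathbf y)$-entry $|\mathcal X|(\mathbf E_{D-1})_{\mathbf x\mathbf y}$, where $\mathbf E_{D-1}$ is the primitive idempotent of $\mathbf A$ for the eigenvalue $2-D$. Then there exists a unique $\mathcal A$-module structure on $V$ on which $x,y$ act as $\mathbf A,\mathbf A^*_{D-1}$ respectively, and there exists a unique $\mathcal A$-module structure on $V$ on which $x,y$ act as $\mathbf A,-\mathbf A^*_{D-1}$ respectively.
   Context: $Q_D$ has vertex set $\mathcal X=\{0,1\}^D$, two vertices adjacent iff they differ in exactly one coordinate; $\partial$ is Hamming distance. $V=\mathbb C^{\mathcal X}$ is the space of column vectors indexed by $\mathcal X$, matrices acting by left multiplication. The primitive idempotent for an eigenvalue is the orthogonal projection onto its eigenspace. Equivalently, $\mathbf A^*_{D-1}$ is diagonal with $(\mathbf y,\mathbf y)$-entry $(-1)^i(D-2i)$, $i=\partial(\mathbf x,\mathbf y)$. $\mathcal A$ is the unital associative $\mathbb C$-algebra with generators $x,y,z$ and relations $xy+yx=2z$, $yz+zy=2x$, $zx+xz=2y$. -}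

module Defs where

open import Level using (Level; _⊔_)
open import Data.Nat as ℕ using (ℕ; zero; suc)
open import Data.Bool using (Bool; true; false; _≟_)
open import Data.Vec using (Vec; []; _∷_)
open import Data.Product using (Σ; _×_; _,_)
open import Relation.Nullary using (¬_; yes; no)
open import Algebra.Bundles using (CommutativeRing)
import Data.Vec.Properties as VP

record Field (c ℓ : Level) : Set (Level.suc (c ⊔ ℓ)) where
  field
    commRing : CommutativeRing c ℓ
  open CommutativeRing commRing public
  field
    1≉0     : ¬ (1# ≈ 0#)
    inverse : ∀ a → ¬ (a ≈ 0#) → Σ Carrier (λ b → a * b ≈ 1#)

module _ {c ℓ : Level} (F : Field c ℓ) where
  open Field F

  natF : ℕ → Carrier
  natF zero    = 0#
  natF (suc n) = 1# + natF n

  CharZero : Set ℓ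
  CharZero = ∀ n → ¬ (natF (suc n) ≈ 0#)

  -- vertex set 𝒳 = {0,1}^D of the D-cube, as bit vectors
  -- square matrices indexed by 𝒳 with entries in F
  Mat : ℕ → Set c
  Mat D = Vec Bool D → Vec Bool D → Carrier

  sumX : (D : ℕ) → (Vec Bool D → Carrier) → Carrier
  sumX zero    f = f []
  sumX (suc D) f = sumX D (λ v → f (false ∷ v)) + sumX D (λ v → f (true ∷ v))

  _·_ : ∀ {D} → Mat D → Mat D → Mat D
  _·_ {D} M N u w = sumX D (λ v → M u v * N v w)

  _⊕_ : ∀ {D} → Mat D → Mat D → Mat D
  (M ⊕ N) u w = M u w + N u w

  scal : ∀ {D} → Carrier → Mat D → Mat D
  scal a M u w = a * M u w

  neg : ∀ {D} → Mat D → Mat D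
  neg M u w = - M u w

  _≈M_ : ∀ {D} → Mat D → Mat D → Set ℓ
  M ≈M N = ∀ u w → M u w ≈ N u w

  ham : ∀ {D} → Vec Bool D → Vec Bool D → ℕ
  ham []      []      = 0
  ham (a ∷ u) (b ∷ w) with a ≟ b
  ... | yes _ = ham u w
  ... | no  _ = suc (ham u w)

  adj : (D : ℕ) → Mat D
  adj D u w with ham u w
  ... | 1 = 1#
  ... | _ = 0#

  sgn : ℕ → Carrier
  sgn zero    = 1#
  sgn (suc i) = - sgn i

  -- 𝐀*_{D-1} with respect to base vertex x: diagonal, (y,y)-entry
  -- |𝒳| (𝐄_{D-1})_{xy} = (-1)^i (D - 2i), i = ∂(x,y)
  dualAdj : (D : ℕ) → Vec Bool D → Mat D
  dualAdj D x u w with VP.≡-dec _≟_ u w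
  ... | yes _ = sgn (ham x u) * (natF D - natF (2 ℕ.* ham x u))
  ... | no  _ = 0#

  -- An 𝒜-module structure on V = F^𝒳 is an algebra homomorphism 𝒜 → End(V);
  -- by the presentation of 𝒜 this is exactly a triple (X, Y, Z) of matrices
  -- (the actions of x, y, z) satisfying the defining relations of 𝒜.
  IsAModule : ∀ {D} → Mat D → Mat D → Mat D → Set ℓ
  IsAModule X Y Z =
      ((X · Y) ⊕ (Y · X)) ≈M scal (natF 2) Z
    × ((Y · Z) ⊕ (Z · Y)) ≈M scal (natF 2) X
    × ((Z · X) ⊕ (X · Z)) ≈M scal (natF 2) Y

  -- there is a unique 𝒜-module structure on V in which x, y act as X, Y
  -- (uniqueness: any two such structures agree, i.e. z acts the same way)
  UniqueAModule : ∀ {D} → Mat D → Mat D → Set (c ⊔ ℓ)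
  UniqueAModule X Y =
    Σ (Mat _) (λ Z → IsAModule X Y Z × (∀ Z′ → IsAModule X Y Z′ → Z′ ≈M Z))

{-# OPTIONS --safe #-}
-- Induction on D along the first coordinate.  Let S = diag((-1)^∂(x,y)) and let
-- ε = ±1 according to the first bit of x.  In block form with respect to the first
-- coordinate, A = [[A, 1], [1, A]], S = diag(ε S, -ε S), A* = diag(S + ε A*, S - ε A*),
-- and z is made to act as Z = [[ε Z, S], [S, -ε Z]].  The relations of 𝒜 for
-- (A, A*, Z) then hold blockwise, given those in dimension D - 1 together with
-- AS = -SA, SZ = -ZS, S² = 1 and A*S = SA*, which propagate in the same way.
-- Uniqueness holds because z must act as (xy + yx)/2, and the second structure is
-- the image of the first under the automorphism y ↦ -y, z ↦ -z of 𝒜.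
module Submission where

open import Defs
open import Level using (Level)
open import Data.Nat using (ℕ; zero; suc; _≤_)
import Data.Nat as ℕ
open import Data.Nat.Properties using (*-suc)
open import Data.Bool using (Bool; true; false; _≟_)
open import Data.Vec using (Vec; []; _∷_)
import Data.Vec.Properties as Vec
open import Data.Product using (_×_; _,_)
open import Relation.Binary.PropositionalEquality as ≡ using (_≡_; _≢_)
open import Relation.Nullary using (¬_; yes; no; contradiction)
open import Function using (_∘_)

module _ {c ℓ : Level} (F : Field c ℓ) where
  open Field F
  open import Relation.Binary.Reasoning.Setoid setoid
  open import Algebra.Solver.Ring.NaturalCoefficients.Default commutativeSemiring
  open import Algebra.Properties.Ring ring
    using (-1*x≈-x; -‿distribˡ-*; -‿distribʳ-*; -‿involutive; -‿+-comm)

  private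
    Σᵛ : (D : ℕ) → (Vec Bool D → Carrier) → Carrier
    Σᵛ = sumX F

    infix  4 _≋_
    infixl 6 _⊞_
    infixl 7 _⋆_
    infixr 8 _•_

    _≋_ : ∀ {D} → Mat F D → Mat F D → Set ℓ
    _≋_ = _≈M_ F

    _⋆_ _⊞_ : ∀ {D} → Mat F D → Mat F D → Mat F D
    _⋆_ = _·_ F
    _⊞_ = _⊕_ F

    _•_ : ∀ {D} → Carrier → Mat F D → Mat F D
    _•_ = scal F

    two : Carrier
    two = 1# + 1#

  sumX-cong : ∀ D {f g : Vec Bool D → Carrier} → (∀ v → f v ≈ g v) → Σᵛ D f ≈ Σᵛ D g
  sumX-cong zero    f≈g = f≈g []
  sumX-cong (suc D) f≈g =
    +-cong (sumX-cong D (λ v → f≈g (false ∷ v))) (sumX-cong D (λ v → f≈g (true ∷ v)))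

  sumX-zero : ∀ D {f : Vec Bool D → Carrier} → (∀ v → f v ≈ 0#) → Σᵛ D f ≈ 0#
  sumX-zero zero    f≈0 = f≈0 []
  sumX-zero (suc D) f≈0 =
    trans (+-cong (sumX-zero D (λ v → f≈0 (false ∷ v))) (sumX-zero D (λ v → f≈0 (true ∷ v))))
      (+-identityˡ 0#)

  sumX-+ : ∀ D (f g : Vec Bool D → Carrier) → Σᵛ D (λ v → f v + g v) ≈ Σᵛ D f + Σᵛ D g
  sumX-+ zero    f g = refl
  sumX-+ (suc D) f g = trans (+-cong (sumX-+ D _ _) (sumX-+ D _ _))
    (solve 4 (λ a b c d → (a :+ b) :+ (c :+ d) := (a :+ c) :+ (b :+ d)) refl _ _ _ _)

  sumX-* : ∀ D a (f : Vec Bool D → Carrier) → Σᵛ D (λ v → a * f v) ≈ a * Σᵛ D f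
  sumX-* zero    a f = refl
  sumX-* (suc D) a f = trans (+-cong (sumX-* D a _) (sumX-* D a _)) (sym (distribˡ a _ _))

  sumX-neg : ∀ D (f : Vec Bool D → Carrier) → Σᵛ D (λ v → - f v) ≈ - Σᵛ D f
  sumX-neg D f = begin
    Σᵛ D (λ v → - f v)       ≈⟨ sumX-cong D (λ v → sym (-1*x≈-x (f v))) ⟩
    Σᵛ D (λ v → - 1# * f v)  ≈⟨ sumX-* D (- 1#) f ⟩
    - 1# * Σᵛ D f            ≈⟨ -1*x≈-x _ ⟩
    - Σᵛ D f                 ∎

  blk : ∀ {D} → Mat F D → Mat F D → Mat F D → Mat F D → Mat F (suc D)
  blk P Q R T (false ∷ u) (false ∷ w) = P u w
  blk P Q R T (false ∷ u) (true  ∷ w) = Q u w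
  blk P Q R T (true  ∷ u) (false ∷ w) = R u w
  blk P Q R T (true  ∷ u) (true  ∷ w) = T u w

  0ᴹ : ∀ {D} → Mat F D
  0ᴹ _ _ = 0#

  1ᴹ : ∀ D → Mat F D
  1ᴹ zero    _ _ = 1#
  1ᴹ (suc D) = blk (1ᴹ D) 0ᴹ 0ᴹ (1ᴹ D)

  module _ {D : ℕ} where
    ⋆-cong : ∀ {P P′ Q Q′ : Mat F D} → P ≋ P′ → Q ≋ Q′ → P ⋆ Q ≋ P′ ⋆ Q′
    ⋆-cong P≋P′ Q≋Q′ u w = sumX-cong D (λ v → *-cong (P≋P′ u v) (Q≋Q′ v w))

    ⋆-zeroˡ : ∀ (P : Mat F D) → 0ᴹ ⋆ P ≋ 0ᴹ
    ⋆-zeroˡ P u w = sumX-zero D (λ v → zeroˡ _)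

    ⋆-zeroʳ : ∀ (P : Mat F D) → P ⋆ 0ᴹ ≋ 0ᴹ
    ⋆-zeroʳ P u w = sumX-zero D (λ v → zeroʳ _)

    •-⋆ : ∀ a (P Q : Mat F D) → a • P ⋆ Q ≋ a • (P ⋆ Q)
    •-⋆ a P Q u w = trans (sumX-cong D (λ v → *-assoc _ _ _)) (sumX-* D a _)

    ⋆-• : ∀ a (P Q : Mat F D) → P ⋆ a • Q ≋ a • (P ⋆ Q)
    ⋆-• a P Q u w = trans (sumX-cong D (λ v → x*[a*y]≈a*[x*y] _ a _)) (sumX-* D a _)
      where
      x*[a*y]≈a*[x*y] : ∀ x a y → x * (a * y) ≈ a * (x * y)
      x*[a*y]≈a*[x*y] = solve 3 (λ x a y → x :* (a :* y) := a :* (x :* y)) refl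

    ⊞-⋆ : ∀ (P Q R : Mat F D) → (P ⊞ Q) ⋆ R ≋ P ⋆ R ⊞ Q ⋆ R
    ⊞-⋆ P Q R u w = trans (sumX-cong D (λ v → distribʳ _ _ _)) (sumX-+ D _ _)

    ⋆-⊞ : ∀ (P Q R : Mat F D) → R ⋆ (P ⊞ Q) ≋ R ⋆ P ⊞ R ⋆ Q
    ⋆-⊞ P Q R u w = trans (sumX-cong D (λ v → distribˡ _ _ _)) (sumX-+ D _ _)

    neg-⋆ : ∀ (P Q : Mat F D) → neg F P ⋆ Q ≋ neg F (P ⋆ Q)
    neg-⋆ P Q u w = trans (sumX-cong D (λ v → sym (-‿distribˡ-* _ _))) (sumX-neg D _)

    ⋆-neg : ∀ (P Q : Mat F D) → P ⋆ neg F Q ≋ neg F (P ⋆ Q)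
    ⋆-neg P Q u w = trans (sumX-cong D (λ v → sym (-‿distribʳ-* _ _))) (sumX-neg D _)

  sumX-1ᴹˡ : ∀ D (f : Vec Bool D → Carrier) u → Σᵛ D (λ v → 1ᴹ D u v * f v) ≈ f u
  sumX-1ᴹˡ zero    f [] = *-identityˡ (f [])
  sumX-1ᴹˡ (suc D) f (false ∷ u) =
    trans (+-cong (sumX-1ᴹˡ D _ u) (sumX-zero D (λ v → zeroˡ _))) (+-identityʳ _)
  sumX-1ᴹˡ (suc D) f (true ∷ u) =
    trans (+-cong (sumX-zero D (λ v → zeroˡ _)) (sumX-1ᴹˡ D _ u)) (+-identityˡ _)

  sumX-1ᴹʳ : ∀ D (f : Vec Bool D → Carrier) w → Σᵛ D (λ v → f v * 1ᴹ D v w) ≈ f w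
  sumX-1ᴹʳ zero    f [] = *-identityʳ (f [])
  sumX-1ᴹʳ (suc D) f (false ∷ w) =
    trans (+-cong (sumX-1ᴹʳ D _ w) (sumX-zero D (λ v → zeroʳ _))) (+-identityʳ _)
  sumX-1ᴹʳ (suc D) f (true ∷ w) =
    trans (+-cong (sumX-zero D (λ v → zeroʳ _)) (sumX-1ᴹʳ D _ w)) (+-identityˡ _)

  ⋆-identityˡ : ∀ {D} (P : Mat F D) → 1ᴹ D ⋆ P ≋ P
  ⋆-identityˡ {D} P u w = sumX-1ᴹˡ D (λ v → P v w) u

  ⋆-identityʳ : ∀ {D} (P : Mat F D) → P ⋆ 1ᴹ D ≋ P
  ⋆-identityʳ {D} P u w = sumX-1ᴹʳ D (P u) w

  module _ {D : ℕ} where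
    •-⋆-• : ∀ a b (P Q : Mat F D) → a • P ⋆ b • Q ≋ a • b • (P ⋆ Q)
    •-⋆-• a b P Q u w = trans (•-⋆ a P (b • Q) u w) (*-cong refl (⋆-• b P Q u w))

    ⊞•-⋆ : ∀ (P : Mat F D) a (Q R : Mat F D) → (P ⊞ a • Q) ⋆ R ≋ P ⋆ R ⊞ a • (Q ⋆ R)
    ⊞•-⋆ P a Q R u w = trans (⊞-⋆ P (a • Q) R u w) (+-cong refl (•-⋆ a Q R u w))

    ⋆-⊞• : ∀ (P : Mat F D) a (Q R : Mat F D) → R ⋆ (P ⊞ a • Q) ≋ R ⋆ P ⊞ a • (R ⋆ Q)
    ⋆-⊞• P a Q R u w = trans (⋆-⊞ P (a • Q) R u w) (+-cong refl (⋆-• a R Q u w))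

    ⊞•-⋆-• : ∀ (P : Mat F D) a (Q : Mat F D) b (R : Mat F D) → (P ⊞ a • Q) ⋆ b • R ≋ b • (P ⋆ R ⊞ a • (Q ⋆ R))
    ⊞•-⋆-• P a Q b R u w = trans (⋆-• b (P ⊞ a • Q) R u w) (*-cong refl (⊞•-⋆ P a Q R u w))

    •-⋆-⊞• : ∀ b (R P : Mat F D) a (Q : Mat F D) → b • R ⋆ (P ⊞ a • Q) ≋ b • (R ⋆ P ⊞ a • (R ⋆ Q))
    •-⋆-⊞• b R P a Q u w = trans (•-⋆ b R (P ⊞ a • Q) u w) (*-cong refl (⋆-⊞• P a Q R u w))

  ε : Bool → Bool → Carrier
  ε false false = 1#
  ε false true  = - 1#
  ε true  false = - 1#
  ε true  true  = 1#

  -1*-1≈1 : - 1# * - 1# ≈ 1#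
  -1*-1≈1 = trans (-1*x≈-x (- 1#)) (-‿involutive 1#)

  ε-square : ∀ b a → ε b a * ε b a ≈ 1#
  ε-square false false = *-identityˡ 1#
  ε-square false true  = -1*-1≈1
  ε-square true  false = -1*-1≈1
  ε-square true  true  = *-identityˡ 1#

  ε-cancel : ∀ b → ε b false + ε b true ≈ 0#
  ε-cancel false = -‿inverseʳ 1#
  ε-cancel true  = -‿inverseˡ 1#

  xMat : ∀ D → Mat F D
  xMat zero    = 0ᴹ
  xMat (suc D) = blk (xMat D) (1ᴹ D) (1ᴹ D) (xMat D)

  sMat : ∀ {D} → Vec Bool D → Mat F D
  sMat []      = 1ᴹ 0
  sMat (b ∷ x) = blk (ε b false • sMat x) 0ᴹ 0ᴹ (ε b true • sMat x)

  yMat : ∀ {D} → Vec Bool D → Mat F D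
  yMat []      = 0ᴹ
  yMat (b ∷ x) = blk (sMat x ⊞ ε b false • yMat x) 0ᴹ 0ᴹ (sMat x ⊞ ε b true • yMat x)

  zMat : ∀ {D} → Vec Bool D → Mat F D
  zMat []      = 0ᴹ
  zMat (b ∷ x) = blk (ε b false • zMat x) (sMat x) (sMat x) (ε b true • zMat x)

  record Invariants {D} (x : Vec Bool D) : Set ℓ where
    field
      xs-anticomm : xMat D ⋆ sMat x ⊞ sMat x ⋆ xMat D ≋ 0ᴹ
      sz-anticomm : sMat x ⋆ zMat x ⊞ zMat x ⋆ sMat x ≋ 0ᴹ
      ss-identity : sMat x ⋆ sMat x ≋ 1ᴹ D
      ys-comm     : yMat x ⋆ sMat x ≋ sMat x ⋆ yMat x
      xy-relation : xMat D ⋆ yMat x ⊞ yMat x ⋆ xMat D ≋ two • zMat x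
      yz-relation : yMat x ⋆ zMat x ⊞ zMat x ⋆ yMat x ≋ two • xMat D
      zx-relation : zMat x ⋆ xMat D ⊞ xMat D ⋆ zMat x ≋ two • yMat x

  invariants-[] : Invariants []
  invariants-[] = record
    { xs-anticomm = λ { [] [] → solve 1 (λ s → con 0 :* s :+ s :* con 0 := con 0) refl 1# }
    ; sz-anticomm = λ { [] [] → solve 1 (λ s → s :* con 0 :+ con 0 :* s := con 0) refl 1# }
    ; ss-identity = λ { [] [] → *-identityˡ 1# }
    ; ys-comm     = λ { [] [] → solve 1 (λ s → con 0 :* s := s :* con 0) refl 1# }
    ; xy-relation = λ { [] [] → 0+0≈2*0 }
    ; yz-relation = λ { [] [] → 0+0≈2*0 }
    ; zx-relation = λ { [] [] → 0+0≈2*0 }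
    }
    where
    0+0≈2*0 : 0# * 0# + 0# * 0# ≈ two * 0#
    0+0≈2*0 = solve 0 (con 0 :* con 0 :+ con 0 :* con 0 := con 2 :* con 0) refl

  -- blk is matched against the first coordinate, along which sumX also splits, so each
  -- entry of a product of block matrices reduces to a sum of two products in dimension D.
  module Extend (b : Bool) {D : ℕ} {x : Vec Bool D} (inv : Invariants x) where
    open Invariants inv
    private
      e₀ e₁ : Carrier
      e₀ = ε b false
      e₁ = ε b true
      X S Y Z 𝟏 : Mat F D
      X = xMat D
      S = sMat x
      Y = yMat x
      Z = zMat x
      𝟏 = 1ᴹ D

      scale-zero : ∀ a {t} → t ≈ 0# → a * t ≈ 0#
      scale-zero a t≈0 = trans (*-cong refl t≈0) (zeroʳ a)

      signs-cancel : ∀ t → (e₀ + e₁) * t ≈ 0#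
      signs-cancel t = trans (*-cong (ε-cancel b) refl) (zeroˡ t)

      unit-square : ∀ a {t t′} → a * a ≈ 1# → t ≈ t′ → (a * a) * t ≈ t′
      unit-square a {t′ = t′} a²≈1 t≈t′ = trans (*-cong a²≈1 t≈t′) (*-identityˡ t′)

      collect : ∀ e₀ e₁ s → (e₀ * s + 0#) + (0# + e₁ * s) ≈ (e₀ + e₁) * s
      collect = solve 3 (λ e₀ e₁ s → (e₀ :* s :+ con 0) :+ (con 0 :+ e₁ :* s) := (e₀ :+ e₁) :* s) refl

      collect′ : ∀ e₀ e₁ s → (0# + e₁ * s) + (e₀ * s + 0#) ≈ (e₀ + e₁) * s
      collect′ = solve 3 (λ e₀ e₁ s → (con 0 :+ e₁ :* s) :+ (e₀ :* s :+ con 0) := (e₀ :+ e₁) :* s) refl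

    xs-anticomm′ : xMat (suc D) ⋆ sMat (b ∷ x) ⊞ sMat (b ∷ x) ⋆ xMat (suc D) ≋ 0ᴹ
    xs-anticomm′ (false ∷ u) (false ∷ w) =
      trans (+-cong (+-cong (⋆-• e₀ X S u w) (⋆-zeroʳ 𝟏 u w))
                    (+-cong (•-⋆ e₀ S X u w) (⋆-zeroˡ 𝟏 u w)))
        (trans (solve 3 (λ e p q → (e :* p :+ con 0) :+ (e :* q :+ con 0) := e :* (p :+ q)) refl e₀ _ _)
          (scale-zero e₀ (xs-anticomm u w)))
    xs-anticomm′ (false ∷ u) (true ∷ w) =
      trans (+-cong (+-cong (⋆-zeroʳ X u w) (⋆-identityˡ (e₁ • S) u w))
                    (+-cong (⋆-identityʳ (e₀ • S) u w) (⋆-zeroˡ X u w)))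
        (trans (collect′ e₀ e₁ _) (signs-cancel _))
    xs-anticomm′ (true ∷ u) (false ∷ w) =
      trans (+-cong (+-cong (⋆-identityˡ (e₀ • S) u w) (⋆-zeroʳ X u w))
                    (+-cong (⋆-zeroˡ X u w) (⋆-identityʳ (e₁ • S) u w)))
        (trans (collect e₀ e₁ _) (signs-cancel _))
    xs-anticomm′ (true ∷ u) (true ∷ w) =
      trans (+-cong (+-cong (⋆-zeroʳ 𝟏 u w) (⋆-• e₁ X S u w))
                    (+-cong (⋆-zeroˡ 𝟏 u w) (•-⋆ e₁ S X u w)))
        (trans (solve 3 (λ e p q → (con 0 :+ e :* p) :+ (con 0 :+ e :* q) := e :* (p :+ q)) refl e₁ _ _)
          (scale-zero e₁ (xs-anticomm u w)))

    sz-anticomm′ : sMat (b ∷ x) ⋆ zMat (b ∷ x) ⊞ zMat (b ∷ x) ⋆ sMat (b ∷ x) ≋ 0ᴹ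
    sz-anticomm′ (false ∷ u) (false ∷ w) =
      trans (+-cong (+-cong (•-⋆-• e₀ e₀ S Z u w) (⋆-zeroˡ S u w))
                    (+-cong (•-⋆-• e₀ e₀ Z S u w) (⋆-zeroʳ S u w)))
        (trans (solve 3 (λ e p q → (e :* (e :* p) :+ con 0) :+ (e :* (e :* q) :+ con 0)
                         := (e :* e) :* (p :+ q)) refl e₀ _ _)
          (scale-zero (e₀ * e₀) (sz-anticomm u w)))
    sz-anticomm′ (false ∷ u) (true ∷ w) =
      trans (+-cong (+-cong (•-⋆ e₀ S S u w) (⋆-zeroˡ (e₁ • Z) u w))
                    (+-cong (⋆-zeroʳ (e₀ • Z) u w) (⋆-• e₁ S S u w)))
        (trans (collect e₀ e₁ _) (signs-cancel _))
    sz-anticomm′ (true ∷ u) (false ∷ w) =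
      trans (+-cong (+-cong (⋆-zeroˡ (e₀ • Z) u w) (•-⋆ e₁ S S u w))
                    (+-cong (⋆-• e₀ S S u w) (⋆-zeroʳ (e₁ • Z) u w)))
        (trans (collect′ e₀ e₁ _) (signs-cancel _))
    sz-anticomm′ (true ∷ u) (true ∷ w) =
      trans (+-cong (+-cong (⋆-zeroˡ S u w) (•-⋆-• e₁ e₁ S Z u w))
                    (+-cong (⋆-zeroʳ S u w) (•-⋆-• e₁ e₁ Z S u w)))
        (trans (solve 3 (λ e p q → (con 0 :+ e :* (e :* p)) :+ (con 0 :+ e :* (e :* q))
                         := (e :* e) :* (p :+ q)) refl e₁ _ _)
          (scale-zero (e₁ * e₁) (sz-anticomm u w)))

    ss-identity′ : sMat (b ∷ x) ⋆ sMat (b ∷ x) ≋ 1ᴹ (suc D)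
    ss-identity′ (false ∷ u) (false ∷ w) =
      trans (+-cong (•-⋆-• e₀ e₀ S S u w) (⋆-zeroˡ 0ᴹ u w))
        (trans (solve 2 (λ e p → e :* (e :* p) :+ con 0 := (e :* e) :* p) refl e₀ _)
          (unit-square e₀ (ε-square b false) (ss-identity u w)))
    ss-identity′ (false ∷ u) (true ∷ w) =
      trans (+-cong (⋆-zeroʳ (e₀ • S) u w) (⋆-zeroˡ (e₁ • S) u w)) (+-identityˡ 0#)
    ss-identity′ (true ∷ u) (false ∷ w) =
      trans (+-cong (⋆-zeroˡ (e₀ • S) u w) (⋆-zeroʳ (e₁ • S) u w)) (+-identityˡ 0#)
    ss-identity′ (true ∷ u) (true ∷ w) =
      trans (+-cong (⋆-zeroˡ 0ᴹ u w) (•-⋆-• e₁ e₁ S S u w))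
        (trans (solve 2 (λ e p → con 0 :+ e :* (e :* p) := (e :* e) :* p) refl e₁ _)
          (unit-square e₁ (ε-square b true) (ss-identity u w)))

    ys-comm-block : ∀ a → (S ⊞ a • Y) ⋆ a • S ≋ a • S ⋆ (S ⊞ a • Y)
    ys-comm-block a u w = begin
      ((S ⊞ a • Y) ⋆ a • S) u w            ≈⟨ ⊞•-⋆-• S a Y a S u w ⟩
      a * ((S ⋆ S) u w + a * (Y ⋆ S) u w)  ≈⟨ *-cong refl (+-cong refl (*-cong refl (ys-comm u w))) ⟩
      a * ((S ⋆ S) u w + a * (S ⋆ Y) u w)  ≈⟨ •-⋆-⊞• a S S a Y u w ⟨
      (a • S ⋆ (S ⊞ a • Y)) u w            ∎

    ys-comm′ : yMat (b ∷ x) ⋆ sMat (b ∷ x) ≋ sMat (b ∷ x) ⋆ yMat (b ∷ x)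
    ys-comm′ (false ∷ u) (false ∷ w) = +-cong (ys-comm-block e₀ u w) refl
    ys-comm′ (false ∷ u) (true ∷ w) =
      trans (+-cong (⋆-zeroʳ (S ⊞ e₀ • Y) u w) (⋆-zeroˡ (e₁ • S) u w))
        (sym (+-cong (⋆-zeroʳ (e₀ • S) u w) (⋆-zeroˡ (S ⊞ e₁ • Y) u w)))
    ys-comm′ (true ∷ u) (false ∷ w) =
      trans (+-cong (⋆-zeroˡ (e₀ • S) u w) (⋆-zeroʳ (S ⊞ e₁ • Y) u w))
        (sym (+-cong (⋆-zeroˡ (S ⊞ e₀ • Y) u w) (⋆-zeroʳ (e₁ • S) u w)))
    ys-comm′ (true ∷ u) (true ∷ w) = +-cong refl (ys-comm-block e₁ u w)

    xy-diagonal : ∀ a u w →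
      ((X ⋆ S) u w + (S ⋆ X) u w) + a * ((X ⋆ Y) u w + (Y ⋆ X) u w) ≈ two * (a * Z u w)
    xy-diagonal a u w =
      trans (+-cong (xs-anticomm u w) (*-cong refl (xy-relation u w)))
        (solve 2 (λ a z → con 0 :+ a :* (con 2 :* z) := con 2 :* (a :* z)) refl a _)

    xy-off-diagonal : ∀ u w → two * S u w + (e₀ + e₁) * Y u w ≈ two * S u w
    xy-off-diagonal u w = trans (+-cong refl (signs-cancel _)) (+-identityʳ _)

    xy-relation′ : xMat (suc D) ⋆ yMat (b ∷ x) ⊞ yMat (b ∷ x) ⋆ xMat (suc D) ≋ two • zMat (b ∷ x)
    xy-relation′ (false ∷ u) (false ∷ w) =
      trans (+-cong (+-cong (⋆-⊞• S e₀ Y X u w) (⋆-zeroʳ 𝟏 u w))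
                    (+-cong (⊞•-⋆ S e₀ Y X u w) (⋆-zeroˡ 𝟏 u w)))
        (trans (regroup e₀ _ _ _ _) (xy-diagonal e₀ u w))
      where
      regroup : ∀ e p q r s → ((p + e * q) + 0#) + ((r + e * s) + 0#) ≈ (p + r) + e * (q + s)
      regroup = solve 5 (λ e p q r s → ((p :+ e :* q) :+ con 0) :+ ((r :+ e :* s) :+ con 0)
                         := (p :+ r) :+ e :* (q :+ s)) refl
    xy-relation′ (false ∷ u) (true ∷ w) =
      trans (+-cong (+-cong (⋆-zeroʳ X u w) (⋆-identityˡ (S ⊞ e₁ • Y) u w))
                    (+-cong (⋆-identityʳ (S ⊞ e₀ • Y) u w) (⋆-zeroˡ X u w)))
        (trans (solve 4 (λ e₀ e₁ s y → (con 0 :+ (s :+ e₁ :* y)) :+ ((s :+ e₀ :* y) :+ con 0)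
                         := con 2 :* s :+ (e₀ :+ e₁) :* y) refl e₀ e₁ _ _)
          (xy-off-diagonal u w))
    xy-relation′ (true ∷ u) (false ∷ w) =
      trans (+-cong (+-cong (⋆-identityˡ (S ⊞ e₀ • Y) u w) (⋆-zeroʳ X u w))
                    (+-cong (⋆-zeroˡ X u w) (⋆-identityʳ (S ⊞ e₁ • Y) u w)))
        (trans (solve 4 (λ e₀ e₁ s y → ((s :+ e₀ :* y) :+ con 0) :+ (con 0 :+ (s :+ e₁ :* y))
                         := con 2 :* s :+ (e₀ :+ e₁) :* y) refl e₀ e₁ _ _)
          (xy-off-diagonal u w))
    xy-relation′ (true ∷ u) (true ∷ w) =
      trans (+-cong (+-cong (⋆-zeroʳ 𝟏 u w) (⋆-⊞• S e₁ Y X u w))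
                    (+-cong (⋆-zeroˡ 𝟏 u w) (⊞•-⋆ S e₁ Y X u w)))
        (trans (regroup e₁ _ _ _ _) (xy-diagonal e₁ u w))
      where
      regroup : ∀ e p q r s → (0# + (p + e * q)) + (0# + (r + e * s)) ≈ (p + r) + e * (q + s)
      regroup = solve 5 (λ e p q r s → (con 0 :+ (p :+ e :* q)) :+ (con 0 :+ (r :+ e :* s))
                         := (p :+ r) :+ e :* (q :+ s)) refl

    yz-diagonal : ∀ a → a * a ≈ 1# → ∀ u w →
      a * ((S ⋆ Z) u w + (Z ⋆ S) u w) + (a * a) * ((Y ⋆ Z) u w + (Z ⋆ Y) u w) ≈ two * X u w
    yz-diagonal a a²≈1 u w =
      trans (+-cong (scale-zero a (sz-anticomm u w)) (unit-square a a²≈1 (yz-relation u w))) (+-identityˡ _)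

    [s+ay]s≈ss+a[sy] : ∀ a u w → ((S ⊞ a • Y) ⋆ S) u w ≈ (S ⋆ S) u w + a * (S ⋆ Y) u w
    [s+ay]s≈ss+a[sy] a u w = trans (⊞•-⋆ S a Y S u w) (+-cong refl (*-cong refl (ys-comm u w)))

    yz-off-diagonal : ∀ u w → two * (S ⋆ S) u w + (e₀ + e₁) * (S ⋆ Y) u w ≈ two * 𝟏 u w
    yz-off-diagonal u w = trans (+-cong (*-cong refl (ss-identity u w)) (signs-cancel _)) (+-identityʳ _)

    yz-relation′ : yMat (b ∷ x) ⋆ zMat (b ∷ x) ⊞ zMat (b ∷ x) ⋆ yMat (b ∷ x) ≋ two • xMat (suc D)
    yz-relation′ (false ∷ u) (false ∷ w) =
      trans (+-cong (+-cong (⊞•-⋆-• S e₀ Y e₀ Z u w) (⋆-zeroˡ S u w))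
                    (+-cong (•-⋆-⊞• e₀ Z S e₀ Y u w) (⋆-zeroʳ S u w)))
        (trans (solve 5 (λ e p q r s → (e :* (p :+ e :* q) :+ con 0) :+ (e :* (r :+ e :* s) :+ con 0)
                                       := e :* (p :+ r) :+ (e :* e) :* (q :+ s)) refl e₀ _ _ _ _)
          (yz-diagonal e₀ (ε-square b false) u w))
    yz-relation′ (false ∷ u) (true ∷ w) =
      trans (+-cong (+-cong ([s+ay]s≈ss+a[sy] e₀ u w) (⋆-zeroˡ (e₁ • Z) u w))
                    (+-cong (⋆-zeroʳ (e₀ • Z) u w) (⋆-⊞• S e₁ Y S u w)))
        (trans (solve 4 (λ e₀ e₁ p q → ((p :+ e₀ :* q) :+ con 0) :+ (con 0 :+ (p :+ e₁ :* q))
                         := con 2 :* p :+ (e₀ :+ e₁) :* q) refl e₀ e₁ _ _)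
          (yz-off-diagonal u w))
    yz-relation′ (true ∷ u) (false ∷ w) =
      trans (+-cong (+-cong (⋆-zeroˡ (e₀ • Z) u w) ([s+ay]s≈ss+a[sy] e₁ u w))
                    (+-cong (⋆-⊞• S e₀ Y S u w) (⋆-zeroʳ (e₁ • Z) u w)))
        (trans (solve 4 (λ e₀ e₁ p q → (con 0 :+ (p :+ e₁ :* q)) :+ ((p :+ e₀ :* q) :+ con 0)
                         := con 2 :* p :+ (e₀ :+ e₁) :* q) refl e₀ e₁ _ _)
          (yz-off-diagonal u w))
    yz-relation′ (true ∷ u) (true ∷ w) =
      trans (+-cong (+-cong (⋆-zeroˡ S u w) (⊞•-⋆-• S e₁ Y e₁ Z u w))
                    (+-cong (⋆-zeroʳ S u w) (•-⋆-⊞• e₁ Z S e₁ Y u w)))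
        (trans (solve 5 (λ e p q r s → (con 0 :+ e :* (p :+ e :* q)) :+ (con 0 :+ e :* (r :+ e :* s))
                                       := e :* (p :+ r) :+ (e :* e) :* (q :+ s)) refl e₁ _ _ _ _)
          (yz-diagonal e₁ (ε-square b true) u w))

    zx-diagonal : ∀ a u w → a * ((Z ⋆ X) u w + (X ⋆ Z) u w) + two * S u w ≈ two * (S u w + a * Y u w)
    zx-diagonal a u w =
      trans (+-cong (*-cong refl (zx-relation u w)) refl)
        (solve 3 (λ a y s → a :* (con 2 :* y) :+ con 2 :* s := con 2 :* (s :+ a :* y)) refl a _ _)

    zx-off-diagonal : ∀ u w → ((X ⋆ S) u w + (S ⋆ X) u w) + (e₀ + e₁) * Z u w ≈ two * 0#
    zx-off-diagonal u w =
      trans (+-cong (xs-anticomm u w) (signs-cancel _)) (solve 0 (con 0 :+ con 0 := con 2 :* con 0) refl)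

    zx-relation′ : zMat (b ∷ x) ⋆ xMat (suc D) ⊞ xMat (suc D) ⋆ zMat (b ∷ x) ≋ two • yMat (b ∷ x)
    zx-relation′ (false ∷ u) (false ∷ w) =
      trans (+-cong (+-cong (•-⋆ e₀ Z X u w) (⋆-identityʳ S u w))
                    (+-cong (⋆-• e₀ X Z u w) (⋆-identityˡ S u w)))
        (trans (solve 4 (λ e p q s → (e :* p :+ s) :+ (e :* q :+ s)
                         := e :* (p :+ q) :+ con 2 :* s) refl e₀ _ _ _)
          (zx-diagonal e₀ u w))
    zx-relation′ (false ∷ u) (true ∷ w) =
      trans (+-cong (+-cong (⋆-identityʳ (e₀ • Z) u w) refl)
                    (+-cong refl (⋆-identityˡ (e₁ • Z) u w)))
        (trans (solve 5 (λ e₀ e₁ z p q → (e₀ :* z :+ p) :+ (q :+ e₁ :* z)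
                         := (q :+ p) :+ (e₀ :+ e₁) :* z) refl e₀ e₁ _ _ _)
          (zx-off-diagonal u w))
    zx-relation′ (true ∷ u) (false ∷ w) =
      trans (+-cong (+-cong refl (⋆-identityʳ (e₁ • Z) u w))
                    (+-cong (⋆-identityˡ (e₀ • Z) u w) refl))
        (trans (solve 5 (λ e₀ e₁ z p q → (p :+ e₁ :* z) :+ (e₀ :* z :+ q)
                         := (q :+ p) :+ (e₀ :+ e₁) :* z) refl e₀ e₁ _ _ _)
          (zx-off-diagonal u w))
    zx-relation′ (true ∷ u) (true ∷ w) =
      trans (+-cong (+-cong (⋆-identityʳ S u w) (•-⋆ e₁ Z X u w))
                    (+-cong (⋆-identityˡ S u w) (⋆-• e₁ X Z u w)))
        (trans (solve 4 (λ e p q s → (s :+ e :* p) :+ (s :+ e :* q)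
                         := e :* (p :+ q) :+ con 2 :* s) refl e₁ _ _ _)
          (zx-diagonal e₁ u w))

    invariants-∷ : Invariants (b ∷ x)
    invariants-∷ = record
      { xs-anticomm = xs-anticomm′
      ; sz-anticomm = sz-anticomm′
      ; ss-identity = ss-identity′
      ; ys-comm     = ys-comm′
      ; xy-relation = xy-relation′
      ; yz-relation = yz-relation′
      ; zx-relation = zx-relation′
      }

  invariants : ∀ {D} (x : Vec Bool D) → Invariants x
  invariants []      = invariants-[]
  invariants (b ∷ x) = Extend.invariants-∷ b (invariants x)

  atDistance : ℕ → ℕ → Carrier
  atDistance zero    zero    = 1#
  atDistance (suc k) (suc n) = atDistance k n
  atDistance _       _       = 0#

  1ᴹ-ham : ∀ {D} (u w : Vec Bool D) → 1ᴹ D u w ≡ atDistance 0 (ham F u w)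
  1ᴹ-ham []          []          = ≡.refl
  1ᴹ-ham (false ∷ u) (false ∷ w) = 1ᴹ-ham u w
  1ᴹ-ham (false ∷ u) (true  ∷ w) = ≡.refl
  1ᴹ-ham (true  ∷ u) (false ∷ w) = ≡.refl
  1ᴹ-ham (true  ∷ u) (true  ∷ w) = 1ᴹ-ham u w

  xMat-ham : ∀ {D} (u w : Vec Bool D) → xMat D u w ≡ atDistance 1 (ham F u w)
  xMat-ham []          []          = ≡.refl
  xMat-ham (false ∷ u) (false ∷ w) = xMat-ham u w
  xMat-ham (false ∷ u) (true  ∷ w) = 1ᴹ-ham u w
  xMat-ham (true  ∷ u) (false ∷ w) = 1ᴹ-ham u w
  xMat-ham (true  ∷ u) (true  ∷ w) = xMat-ham u w

  adj-ham : ∀ D (u w : Vec Bool D) → adj F D u w ≡ atDistance 1 (ham F u w)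
  adj-ham D u w with ham F u w
  ... | zero        = ≡.refl
  ... | suc zero    = ≡.refl
  ... | suc (suc n) = ≡.refl

  xMat≋adj : ∀ D → xMat D ≋ adj F D
  xMat≋adj D u w = reflexive (≡.trans (xMat-ham u w) (≡.sym (adj-ham D u w)))

  1ᴹ-refl : ∀ {D} (u : Vec Bool D) → 1ᴹ D u u ≈ 1#
  1ᴹ-refl []          = refl
  1ᴹ-refl (false ∷ u) = 1ᴹ-refl u
  1ᴹ-refl (true  ∷ u) = 1ᴹ-refl u

  1ᴹ-≢ : ∀ {D} {u w : Vec Bool D} → u ≢ w → 1ᴹ D u w ≈ 0#
  1ᴹ-≢ {u = []}        {[]}        u≢w = contradiction ≡.refl u≢w
  1ᴹ-≢ {u = false ∷ u} {false ∷ w} u≢w = 1ᴹ-≢ (u≢w ∘ ≡.cong (false ∷_))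
  1ᴹ-≢ {u = false ∷ u} {true  ∷ w} u≢w = refl
  1ᴹ-≢ {u = true  ∷ u} {false ∷ w} u≢w = refl
  1ᴹ-≢ {u = true  ∷ u} {true  ∷ w} u≢w = 1ᴹ-≢ (u≢w ∘ ≡.cong (true ∷_))

  dualEntry : ∀ {D} → Vec Bool D → Vec Bool D → Carrier
  dualEntry {D} x u = sgn F (ham F x u) * (natF F D - natF F (2 ℕ.* ham F x u))

  dualAdj-entry : ∀ D (x u w : Vec Bool D) → dualAdj F D x u w ≈ 1ᴹ D u w * dualEntry x u
  dualAdj-entry D x u w with Vec.≡-dec _≟_ u w
  ... | yes ≡.refl = sym (trans (*-cong (1ᴹ-refl u) refl) (*-identityˡ _))
  ... | no  u≢w    = sym (trans (*-cong (1ᴹ-≢ u≢w) refl) (zeroˡ _))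

  sgn-∷ : ∀ b a {D} (x u : Vec Bool D) → sgn F (ham F (b ∷ x) (a ∷ u)) ≈ ε b a * sgn F (ham F x u)
  sgn-∷ false false x u = sym (*-identityˡ _)
  sgn-∷ false true  x u = sym (-1*x≈-x _)
  sgn-∷ true  false x u = sym (-1*x≈-x _)
  sgn-∷ true  true  x u = sym (*-identityˡ _)

  dualEntry-agree : ∀ s d k → s * ((1# + d) + k) ≈ s + 1# * (s * (d + k))
  dualEntry-agree = solve 3 (λ s d k → s :* ((con 1 :+ d) :+ k) := s :+ con 1 :* (s :* (d :+ k))) refl

  -- With m = -1 both sides become semiring expressions, equal modulo m * m ≈ 1 and 1 + m ≈ 0.
  flip-identity : ∀ s d n → - s * ((1# + d) - (1# + (1# + n))) ≈ s + - 1# * (s * (d - n))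
  flip-identity s d n = begin
    - s * ((1# + d) - (1# + (1# + n)))
      ≈⟨ *-cong (sym (-1*x≈-x s)) (+-cong refl (sym (-1*x≈-x _))) ⟩
    (m * s) * ((1# + d) + m * (1# + (1# + n)))
      ≈⟨ solve 4 (λ m s d n → (m :* s) :* ((con 1 :+ d) :+ m :* (con 1 :+ (con 1 :+ n)))
                              := (m :* (s :* d) :+ (m :* m) :* (s :* n))
                                 :+ s :* (m :* m :+ (m :* m :+ m))) refl m s d n ⟩
    (m * (s * d) + (m * m) * (s * n)) + s * (m * m + (m * m + m))
      ≈⟨ +-cong refl (*-cong refl (+-cong -1*-1≈1 (+-cong -1*-1≈1 refl))) ⟩
    (m * (s * d) + (m * m) * (s * n)) + s * (1# + (1# + m))
      ≈⟨ +-cong refl (*-cong refl (+-cong refl (-‿inverseʳ 1#))) ⟩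
    (m * (s * d) + (m * m) * (s * n)) + s * (1# + 0#)
      ≈⟨ solve 4 (λ m s d n → (m :* (s :* d) :+ (m :* m) :* (s :* n)) :+ s :* (con 1 :+ con 0)
                              := s :+ m :* (s :* (d :+ m :* n))) refl m s d n ⟩
    s + m * (s * (d + m * n))
      ≈⟨ +-cong refl (*-cong refl (*-cong refl (+-cong refl (-1*x≈-x n)))) ⟩
    s + m * (s * (d - n))
      ∎
    where
    m : Carrier
    m = - 1#

  dualEntry-disagree : ∀ {D} (x u : Vec Bool D) →
    - sgn F (ham F x u) * ((1# + natF F D) - natF F (2 ℕ.* suc (ham F x u)))
      ≈ sgn F (ham F x u) + - 1# * dualEntry x u
  dualEntry-disagree x u =
    trans (*-cong refl (+-cong refl (-‿cong (reflexive (≡.cong (natF F) (*-suc 2 (ham F x u)))))))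
      (flip-identity _ _ _)

  dualEntry-∷ : ∀ b a {D} (x u : Vec Bool D) →
    dualEntry (b ∷ x) (a ∷ u) ≈ sgn F (ham F x u) + ε b a * dualEntry x u
  dualEntry-∷ false false x u = dualEntry-agree _ _ _
  dualEntry-∷ false true  x u = dualEntry-disagree x u
  dualEntry-∷ true  false x u = dualEntry-disagree x u
  dualEntry-∷ true  true  x u = dualEntry-agree _ _ _

  private
    scaled-entry : ∀ e i s {t} → t ≈ i * s → e * t ≈ i * (e * s)
    scaled-entry e i s t≈is =
      trans (*-cong refl t≈is) (solve 3 (λ e i s → e :* (i :* s) := i :* (e :* s)) refl e i s)

  sMat-sign : ∀ {D} (x u w : Vec Bool D) → sMat x u w ≈ 1ᴹ D u w * sgn F (ham F x u)
  sMat-sign []      []          []          = sym (*-identityˡ 1#)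
  sMat-sign (b ∷ x) (false ∷ u) (false ∷ w) =
    trans (scaled-entry _ _ _ (sMat-sign x u w)) (*-cong refl (sym (sgn-∷ b false x u)))
  sMat-sign (b ∷ x) (true  ∷ u) (true  ∷ w) =
    trans (scaled-entry _ _ _ (sMat-sign x u w)) (*-cong refl (sym (sgn-∷ b true x u)))
  sMat-sign (b ∷ x) (false ∷ u) (true  ∷ w) = sym (zeroˡ _)
  sMat-sign (b ∷ x) (true  ∷ u) (false ∷ w) = sym (zeroˡ _)

  yMat-dual : ∀ {D} (x u w : Vec Bool D) → yMat x u w ≈ 1ᴹ D u w * dualEntry x u
  yMat-dual []      []          []          =
    sym (trans (*-identityˡ _) (trans (*-identityˡ _) (-‿inverseʳ 0#)))
  yMat-dual (b ∷ x) (false ∷ u) (false ∷ w) =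
    trans (+-cong (sMat-sign x u w) (scaled-entry _ _ _ (yMat-dual x u w)))
      (trans (sym (distribˡ _ _ _)) (*-cong refl (sym (dualEntry-∷ b false x u))))
  yMat-dual (b ∷ x) (true  ∷ u) (true  ∷ w) =
    trans (+-cong (sMat-sign x u w) (scaled-entry _ _ _ (yMat-dual x u w)))
      (trans (sym (distribˡ _ _ _)) (*-cong refl (sym (dualEntry-∷ b true x u))))
  yMat-dual (b ∷ x) (false ∷ u) (true  ∷ w) = sym (zeroˡ _)
  yMat-dual (b ∷ x) (true  ∷ u) (false ∷ w) = sym (zeroˡ _)

  yMat≋dualAdj : ∀ D (x : Vec Bool D) → yMat x ≋ dualAdj F D x
  yMat≋dualAdj D x u w = trans (yMat-dual x u w) (sym (dualAdj-entry D x u w))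

  model-isAModule : ∀ {D} (x : Vec Bool D) → IsAModule F (xMat D) (yMat x) (zMat x)
  model-isAModule x =
    (λ u w → trans (xy-relation u w) (*-cong two≈2 refl)) ,
    (λ u w → trans (yz-relation u w) (*-cong two≈2 refl)) ,
    (λ u w → trans (zx-relation u w) (*-cong two≈2 refl))
    where
    open Invariants (invariants x)
    two≈2 : two ≈ natF F 2
    two≈2 = +-cong refl (sym (+-identityʳ 1#))

  module _ {D : ℕ} where
    ≋-sym : ∀ {P Q : Mat F D} → P ≋ Q → Q ≋ P
    ≋-sym P≋Q u w = sym (P≋Q u w)

    ≋-refl : ∀ {P : Mat F D} → P ≋ P
    ≋-refl u w = refl

    neg-⋆-neg : ∀ (P Q : Mat F D) → neg F P ⋆ neg F Q ≋ P ⋆ Q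
    neg-⋆-neg P Q u w =
      trans (neg-⋆ P (neg F Q) u w) (trans (-‿cong (⋆-neg P Q u w)) (-‿involutive _))

    IsAModule-cong : ∀ {X X′ Y Y′ Z : Mat F D} → X ≋ X′ → Y ≋ Y′ → IsAModule F X Y Z → IsAModule F X′ Y′ Z
    IsAModule-cong {X} {X′} {Y} {Y′} {Z} X≋X′ Y≋Y′ (xy , yz , zx) =
      (λ u w → trans (+-cong (⋆-cong X′≋X Y′≋Y u w) (⋆-cong Y′≋Y X′≋X u w)) (xy u w)) ,
      (λ u w → trans (+-cong (⋆-cong Y′≋Y Z≋Z u w) (⋆-cong Z≋Z Y′≋Y u w))
                     (trans (yz u w) (*-cong refl (X≋X′ u w)))) ,
      (λ u w → trans (+-cong (⋆-cong Z≋Z X′≋X u w) (⋆-cong X′≋X Z≋Z u w))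
                     (trans (zx u w) (*-cong refl (Y≋Y′ u w))))
      where
      X′≋X : X′ ≋ X
      X′≋X = ≋-sym X≋X′
      Y′≋Y : Y′ ≋ Y
      Y′≋Y = ≋-sym Y≋Y′
      Z≋Z : Z ≋ Z
      Z≋Z = ≋-refl

    IsAModule-negate : ∀ {X Y Z : Mat F D} → IsAModule F X Y Z → IsAModule F X (neg F Y) (neg F Z)
    IsAModule-negate {X} {Y} {Z} (xy , yz , zx) =
      (λ u w → trans (+-cong (⋆-neg X Y u w) (neg-⋆ Y X u w)) (negate-sum (xy u w))) ,
      (λ u w → trans (+-cong (neg-⋆-neg Y Z u w) (neg-⋆-neg Z Y u w)) (yz u w)) ,
      (λ u w → trans (+-cong (neg-⋆ Z X u w) (⋆-neg X Z u w)) (negate-sum (zx u w)))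
      where
      negate-sum : ∀ {p q a t} → p + q ≈ a * t → - p + - q ≈ a * - t
      negate-sum p+q≈at = trans (-‿+-comm _ _) (trans (-‿cong p+q≈at) (-‿distribʳ-* _ _))

  *-cancelˡ : ∀ {a p q} → ¬ a ≈ 0# → a * p ≈ a * q → p ≈ q
  *-cancelˡ {a} {p} {q} a≉0 ap≈aq with inverse a a≉0
  ... | a⁻¹ , aa⁻¹≈1 = begin
    p              ≈⟨ undo p ⟨
    a⁻¹ * (a * p)  ≈⟨ *-cong refl ap≈aq ⟩
    a⁻¹ * (a * q)  ≈⟨ undo q ⟩
    q              ∎
    where
    undo : ∀ t → a⁻¹ * (a * t) ≈ t
    undo t = begin
      a⁻¹ * (a * t)  ≈⟨ solve 3 (λ a b t → b :* (a :* t) := (a :* b) :* t) refl a a⁻¹ t ⟩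
      (a * a⁻¹) * t  ≈⟨ *-cong aa⁻¹≈1 refl ⟩
      1# * t         ≈⟨ *-identityˡ t ⟩
      t              ∎

  IsAModule-unique : ¬ natF F 2 ≈ 0# → ∀ {D} {X Y Z Z′ : Mat F D} →
                     IsAModule F X Y Z → IsAModule F X Y Z′ → Z′ ≋ Z
  IsAModule-unique 2≉0 (xy , _) (xy′ , _) u w = *-cancelˡ 2≉0 (trans (sym (xy′ u w)) (xy u w))

  uniqueAModule : ¬ natF F 2 ≈ 0# → ∀ {D} {X Y Z : Mat F D} → IsAModule F X Y Z → UniqueAModule F X Y
  uniqueAModule 2≉0 {Z = Z} isModule = Z , isModule , λ Z′ → IsAModule-unique 2≉0 isModule

lemma11p5 : {c ℓ : Level} (F : Field c ℓ) → CharZero F →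
    (D : ℕ) → 1 ≤ D → (x : Vec Bool D) →
    UniqueAModule F (adj F D) (dualAdj F D x)
      × UniqueAModule F (adj F D) (neg F (dualAdj F D x))
lemma11p5 F char0 D _ x =
  uniqueAModule F 2≉0 model , uniqueAModule F 2≉0 (IsAModule-negate F model)
  where
  open Field F using (_≈_; 0#)
  2≉0 : ¬ natF F 2 ≈ 0#
  2≉0 = char0 1
  model : IsAModule F (adj F D) (dualAdj F D x) (zMat F x)
  model = IsAModule-cong F (xMat≋adj F D) (yMat≋dualAdj F D x) (model-isAModule F x)
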